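{- In any execution of Algorithm B, if $id$ and $id'$ are identifiers of correct processes with $id'<id$, then $\text{newid}_p[id']+(N-t)\le\text{newid}_p[id]$ at every correct process $p$.
   Context: System model: $N$ processes in a fully connected synchronous message-passing network with reliable channels; a receiver knows the label of the link on which a message arrived but not the sender's identifier; each correct process has a unique identifier initially known only to itself; up to $t$ processes are Byzantine (arbitrary behavior); throughout, $N>2t^2+t$. "Broadcast" means send to all $N$ links (including a self-loop). Algorithm B (each correct process): Step 1: broadcast $\langle ID, my\_id\rangle$; for each $\langle ID,id\rangle$ received on link $lnk$ set linkid$[lnk]:=id$ and add $id$ to the set timely (linkid$[lnk]=\perp$ for links with no ID message). Step 2: broadcast $\langle MULTIECHO,\text{timely}\rangle$; for each $\langle MULTIECHO, ids\rangle$ received on link $lnk$, if linkid$[lnk]\ne\perp$, $|ids|\le N$ and $|\text{timely}\cap ids|\ge N-t$, then for each $id\in ids$ add $id$ to accepted and increment counter$[id]$ (initially $0$). Then, for each $id\in$ accepted, newid$[id]:=\sum_{id''\in \text{accepted},\, id''\le id}\min(\text{counter}[id''],N-t)$; output newid$[my\_id]$. -}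

module Defs where

open import Data.Nat using (ℕ; _≤_; _≤?_; _≟_; _∸_; _⊓_; _+_)
open import Data.Fin using (Fin)
open import Data.Fin.Subset using (Subset; _∈_; ∣_∣; ∁)
open import Data.Fin.Subset.Properties using (_∈?_)
open import Data.Bool using (Bool; true; false; if_then_else_; _∧_)
open import Data.Maybe using (Maybe; just; nothing; is-just)
open import Data.List using (List; []; _∷_; map; filter; deduplicate; mapMaybe; allFin; length; concat)
open import Data.Nat.ListAction using (sum)
import Data.List.Membership.DecPropositional as DecMem
open import Relation.Nullary using (does)

open DecMem _≟_ using () renaming (_∈?_ to _∈ℕ?_)

-- A finite set of identifiers is represented by a duplicate-free list.
-- `toSet` turns an arbitrary list (e.g. a Byzantine payload) into the set it denotes.
toSet : List ℕ → List ℕ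
toSet = deduplicate _≟_

-- An execution of Algorithm B with N processes (positions Fin N).
--  correct      : the set of correct processes
--  ident q      : the identifier of process q (meaningful for correct q)
--  sender p l   : the process at the other end of link l of process p
--  byz1 p l     : the step-1 message (if any) that p receives on link l when
--                 the sender is Byzantine: just id = ⟨ID,id⟩, nothing = no ID message
--  byz2 p l     : the step-2 message (if any) that p receives on link l when
--                 the sender is Byzantine: just ids = ⟨MULTIECHO,ids⟩
record Execution (N : ℕ) : Set where
  field
    correct : Subset N
    ident   : Fin N → ℕ
    sender  : Fin N → Fin N → Fin N
    byz1    : Fin N → Fin N → Maybe ℕ
    byz2    : Fin N → Fin N → Maybe (List ℕ)

module AlgorithmB {N : ℕ} (t : ℕ) (E : Execution N) where
  open Execution E

  links : List (Fin N)
  links = allFin N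

  isCorrect : Fin N → Bool
  isCorrect q = does (q ∈? correct)

  linkid : Fin N → Fin N → Maybe ℕ
  linkid p l = if isCorrect (sender p l) then just (ident (sender p l)) else byz1 p l

  timely : Fin N → List ℕ
  timely p = toSet (mapMaybe (linkid p) links)

  echo : Fin N → Fin N → Maybe (List ℕ)
  echo p l = if isCorrect (sender p l)
               then just (timely (sender p l))
               else Data.Maybe.map toSet (byz2 p l)

  interSize : Fin N → List ℕ → ℕ
  interSize p ids = length (filter (_∈ℕ? timely p) ids)

  acceptTest : Fin N → Fin N → List ℕ → Bool
  acceptTest p l ids =
    is-just (linkid p l) ∧ (does (length ids ≤? N) ∧ does ((N ∸ t) ≤? interSize p ids))

  acceptEcho : Fin N → Fin N → Maybe (List ℕ)
  acceptEcho p l with echo p l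
  ... | nothing  = nothing
  ... | just ids = if acceptTest p l ids then just ids else nothing

  acceptedEchoes : Fin N → List (List ℕ)
  acceptedEchoes p = mapMaybe (acceptEcho p) links

  accepted : Fin N → List ℕ
  accepted p = toSet (concat (acceptedEchoes p))

  counter : Fin N → ℕ → ℕ
  counter p x = length (filter (x ∈ℕ?_) (acceptedEchoes p))

  newid : Fin N → ℕ → ℕ
  newid p x = sum (map (λ y → counter p y ⊓ (N ∸ t)) (filter (_≤? x) (accepted p)))

{-# OPTIONS --safe #-}
-- In step 1 every process receives the identifier of every correct process, so each timely set
-- contains the at least N − t distinct identifiers of correct processes.  Hence any two timely sets
-- meet in at least N − t elements, and at every process p the MULTIECHO of each correct sender passes
-- the acceptance test.  The identifier id of a correct process lies in all these echoes, so
-- counter_p[id] ≥ N − t and its summand in newid_p is exactly N − t.  That summand occurs in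
-- newid_p[id] but not in newid_p[id′] for id′ < id, while every summand of newid_p[id′] also
-- occurs in newid_p[id].
module Submission where

open import Defs
open import Data.Bool using (true)
open import Data.Fin using (Fin; zero; suc; punchOut)
open import Data.Fin.Properties using (any?; punchOut-injective; injective⇒≤) renaming (_≟_ to _≟ᶠ_)
open import Data.Fin.Subset using (Subset; _∈_; ∣_∣; ∁; inside; outside)
open import Data.Fin.Subset.Properties using (_∈?_; drop-there; ∣∁p∣≡n∸∣p∣; ∣p∣≤n)
open import Data.List using (List; []; _∷_; map; filter; length; mapMaybe; tabulate; allFin)
open import Data.List.Properties
  using (length-removeAt′; filter-accept; filter-reject; length-map; length-tabulate;
         length-catMaybes; length-deduplicate)
import Data.List.Membership.DecPropositional as DecMembership
open import Data.List.Membership.Propositional using () renaming (_∈_ to _∈ₗ_)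
open import Data.List.Membership.Propositional.Properties
  using (∈-filter⁺; ∈-filter⁻; ∈-allFin; ∈-map⁺; ∈-map⁻; ∈-concat⁺′; ∈-deduplicate⁺)
open import Data.List.Relation.Binary.Subset.Propositional using (_⊆_)
import Data.List.Relation.Unary.All as All
import Data.List.Relation.Unary.All.Properties as All
open import Data.List.Relation.Unary.Any using (here; there; index; _─_)
import Data.List.Relation.Unary.Any as Any
import Data.List.Relation.Unary.Any.Properties as Any
open import Data.List.Relation.Unary.Unique.Propositional using (Unique; []; _∷_)
open import Data.List.Relation.Unary.Unique.Propositional.Properties using (filter⁺; allFin⁺)
open import Data.Maybe using (Maybe; just; nothing)
import Data.Maybe.Relation.Unary.Any as Maybe
open import Data.Nat using (ℕ; suc; _≤_; _≰_; _<_; _+_; _*_; _∸_; _⊓_; _≤?_; _≟_; z≤n; s≤s)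
open import Data.Nat.ListAction using (sum)
open import Data.Nat.Properties
  using (≤-refl; ≤-trans; <⇒≤; <⇒≱; n≤1+n; 1+n≰n; +-comm; +-assoc; +-monoʳ-≤; +-monoˡ-≤;
         m≤n⇒m≤o+n; m∸n+n≡m; m≤n+o⇒m∸n≤o; m≥n⇒m⊓n≡n; module ≤-Reasoning)
open import Data.Product using (∃; _×_; _,_; proj₂)
open import Data.Vec using (_∷_; []; here; there)
open import Function using (id; _∘_)
open import Function.Bundles using (_⇔_; mk⇔; Equivalence)
open import Function.Definitions using (Injective)
open import Function.Properties.Equivalence using () renaming (trans to ⇔-trans)
open import Level using (0ℓ)
open import Relation.Binary.PropositionalEquality using (_≡_; _≢_; refl; sym; cong; subst)
open import Relation.Nullary using (yes; no; contradiction)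
open import Relation.Nullary.Decidable using (dec-true)
open import Relation.Unary using (Pred; Decidable)

module _ {A : Set} where

  ∈-─⁺ : ∀ {x y : A} {ys} (x∈ys : x ∈ₗ ys) → y ∈ₗ ys → y ≢ x → y ∈ₗ (ys ─ x∈ys)
  ∈-─⁺ (here refl)  (here refl)  y≢x = contradiction refl y≢x
  ∈-─⁺ (here _)     (there y∈ys) _   = y∈ys
  ∈-─⁺ (there _)    (here refl)  _   = here refl
  ∈-─⁺ (there x∈ys) (there y∈ys) y≢x = there (∈-─⁺ x∈ys y∈ys y≢x)

  Unique-⊆⇒length≤ : ∀ {xs ys : List A} → Unique xs → xs ⊆ ys → length xs ≤ length ys
  Unique-⊆⇒length≤ []                          _     = z≤n
  Unique-⊆⇒length≤ {x ∷ xs} {ys} (x∉xs ∷ xs!) xs⊆ys = begin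
    suc (length xs)           ≤⟨ s≤s (Unique-⊆⇒length≤ xs! xs⊆ys─x) ⟩
    suc (length (ys ─ x∈ys))  ≡⟨ sym (length-removeAt′ ys (index x∈ys)) ⟩
    length ys                 ∎
    where
    open ≤-Reasoning
    x∈ys : x ∈ₗ ys
    x∈ys = xs⊆ys (here refl)
    xs⊆ys─x : xs ⊆ (ys ─ x∈ys)
    xs⊆ys─x y∈xs = ∈-─⁺ x∈ys (xs⊆ys (there y∈xs)) (All.lookup x∉xs y∈xs ∘ sym)

  Unique-map⁺ : ∀ {B : Set} {f : A → B} {xs} →
    (∀ {x y} → x ∈ₗ xs → y ∈ₗ xs → f x ≡ f y → x ≡ y) → Unique xs → Unique (map f xs)
  Unique-map⁺ _ [] = []
  Unique-map⁺ f-inj (x∉xs ∷ xs!) =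
    All.map⁺ (All.tabulate λ y∈xs fx≡fy → All.lookup x∉xs y∈xs (f-inj (here refl) (there y∈xs) fx≡fy))
    ∷ Unique-map⁺ (λ x∈ y∈ → f-inj (there x∈) (there y∈)) xs!

length-filter-∷ : ∀ {A : Set} {Q : Pred A 0ℓ} (Q? : Decidable Q) y ys →
  length (filter Q? ys) ≤ length (filter Q? (y ∷ ys))
length-filter-∷ Q? y ys with Q? y
... | yes _ = n≤1+n _
... | no _  = ≤-refl

module _ {A B : Set} (f : A → Maybe B) where

  ∈-mapMaybe⁺ : ∀ {x y xs} → x ∈ₗ xs → f x ≡ just y → y ∈ₗ mapMaybe f xs
  ∈-mapMaybe⁺ {y = y} {xs} x∈xs fx≡y = Any.mapMaybe⁺ f xs (Any.map⁺ (Any.map reach x∈xs))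
    where
    reach : ∀ {z} → _ ≡ z → Maybe.Any (y ≡_) (f z)
    reach refl rewrite fx≡y = Maybe.just refl

  length-filter≤length-filter-mapMaybe : ∀ {P : Pred A 0ℓ} {Q : Pred B 0ℓ}
    (P? : Decidable P) (Q? : Decidable Q) → (∀ {x} → P x → Maybe.Any Q (f x)) →
    ∀ xs → length (filter P? xs) ≤ length (filter Q? (mapMaybe f xs))
  length-filter≤length-filter-mapMaybe P? Q? P⇒Q [] = z≤n
  length-filter≤length-filter-mapMaybe P? Q? P⇒Q (x ∷ xs) with P? x | f x | P⇒Q {x}
  ... | yes px | just y  | P⇒Qx with Maybe.just qy ← P⇒Qx px
    rewrite filter-accept Q? {xs = mapMaybe f xs} qy =
      s≤s (length-filter≤length-filter-mapMaybe P? Q? P⇒Q xs)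
  ... | yes px | nothing | P⇒Qx with () ← P⇒Qx px
  ... | no _   | nothing | _ = length-filter≤length-filter-mapMaybe P? Q? P⇒Q xs
  ... | no _   | just y  | _ =
    ≤-trans (length-filter≤length-filter-mapMaybe P? Q? P⇒Q xs) (length-filter-∷ Q? y (mapMaybe f xs))

injective⇒surjective : ∀ {n} {f : Fin n → Fin n} → Injective _≡_ _≡_ f → ∀ y → ∃ λ x → f x ≡ y
injective⇒surjective {suc n} {f} f-inj y with any? (λ x → f x ≟ᶠ y)
... | yes hit  = hit
... | no  miss = contradiction (injective⇒≤ punchOut-f-injective) 1+n≰n
  where
  y≢f : ∀ x → y ≢ f x
  y≢f x y≡fx = miss (x , sym y≡fx)
  punchOut-f-injective : Injective _≡_ _≡_ (λ x → punchOut (y≢f x))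
  punchOut-f-injective {x} {x′} = f-inj ∘ punchOut-injective (y≢f x) (y≢f x′)

length-filter-tabulate : ∀ {n} {A : Set} {P : Pred A 0ℓ} (P? : Decidable P) (p : Subset n)
  (g : Fin n → A) → (∀ i → P (g i) ⇔ i ∈ p) → length (filter P? (tabulate g)) ≡ ∣ p ∣
length-filter-tabulate P? []      g Pg⇔p = refl
length-filter-tabulate P? (x ∷ p) g Pg⇔p with P? (g zero) | x
... | yes Pg0 | inside  = cong suc
  (length-filter-tabulate P? p (g ∘ suc) (λ i → ⇔-trans (Pg⇔p (suc i)) (mk⇔ drop-there there)))
... | yes Pg0 | outside with () ← Equivalence.to (Pg⇔p zero) Pg0
... | no ¬Pg0 | inside  = contradiction (Equivalence.from (Pg⇔p zero) here) ¬Pg0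
... | no ¬Pg0 | outside =
  length-filter-tabulate P? p (g ∘ suc) (λ i → ⇔-trans (Pg⇔p (suc i)) (mk⇔ drop-there there))

∣∁p∣≤t⇒n∸t≤∣p∣ : ∀ {n t} (p : Subset n) → ∣ ∁ p ∣ ≤ t → n ∸ t ≤ ∣ p ∣
∣∁p∣≤t⇒n∸t≤∣p∣ {n} {t} p ∣∁p∣≤t = m≤n+o⇒m∸n≤o n t (begin
  n                  ≡⟨ sym (m∸n+n≡m (∣p∣≤n p)) ⟩
  n ∸ ∣ p ∣ + ∣ p ∣  ≡⟨ cong (_+ ∣ p ∣) (sym (∣∁p∣≡n∸∣p∣ p)) ⟩
  ∣ ∁ p ∣ + ∣ p ∣    ≤⟨ +-monoˡ-≤ ∣ p ∣ ∣∁p∣≤t ⟩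
  t + ∣ p ∣          ∎)
  where open ≤-Reasoning

module _ (g : ℕ → ℕ) where

  sumUpTo : ℕ → List ℕ → ℕ
  sumUpTo a ys = sum (map g (filter (_≤? a) ys))

  sumUpTo-accept : ∀ {a y} ys → y ≤ a → sumUpTo a (y ∷ ys) ≡ g y + sumUpTo a ys
  sumUpTo-accept {a} ys y≤a = cong (sum ∘ map g) (filter-accept (_≤? a) {xs = ys} y≤a)

  sumUpTo-reject : ∀ {a y} ys → y ≰ a → sumUpTo a (y ∷ ys) ≡ sumUpTo a ys
  sumUpTo-reject {a} ys y≰a = cong (sum ∘ map g) (filter-reject (_≤? a) {xs = ys} y≰a)

  sumUpTo-mono : ∀ {a b} → a ≤ b → ∀ ys → sumUpTo a ys ≤ sumUpTo b ys
  sumUpTo-mono a≤b []       = z≤n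
  sumUpTo-mono {a} {b} a≤b (y ∷ ys) with y ≤? a | y ≤? b
  ... | yes y≤a | yes y≤b rewrite sumUpTo-accept ys y≤a | sumUpTo-accept ys y≤b =
    +-monoʳ-≤ (g y) (sumUpTo-mono a≤b ys)
  ... | yes y≤a | no y≰b  = contradiction (≤-trans y≤a a≤b) y≰b
  ... | no y≰a  | yes y≤b rewrite sumUpTo-reject ys y≰a | sumUpTo-accept ys y≤b =
    m≤n⇒m≤o+n (g y) (sumUpTo-mono a≤b ys)
  ... | no y≰a  | no y≰b  rewrite sumUpTo-reject ys y≰a | sumUpTo-reject ys y≰b =
    sumUpTo-mono a≤b ys

  sumUpTo-< : ∀ {a b ys} → a < b → b ∈ₗ ys → sumUpTo a ys + g b ≤ sumUpTo b ys
  sumUpTo-< {a} {b} a<b (here {xs = ys} refl)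
    rewrite sumUpTo-reject ys (<⇒≱ a<b) | sumUpTo-accept ys (≤-refl {b}) = begin
      sumUpTo a ys + g b  ≡⟨ +-comm _ (g b) ⟩
      g b + sumUpTo a ys  ≤⟨ +-monoʳ-≤ (g b) (sumUpTo-mono (<⇒≤ a<b) ys) ⟩
      g b + sumUpTo b ys  ∎
    where open ≤-Reasoning
  sumUpTo-< {a} {b} a<b (there {y} {ys} b∈ys) with y ≤? a | y ≤? b
  ... | yes y≤a | yes y≤b rewrite sumUpTo-accept ys y≤a | sumUpTo-accept ys y≤b = begin
    g y + sumUpTo a ys + g b    ≡⟨ +-assoc (g y) _ _ ⟩
    g y + (sumUpTo a ys + g b)  ≤⟨ +-monoʳ-≤ (g y) (sumUpTo-< a<b b∈ys) ⟩
    g y + sumUpTo b ys          ∎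
    where open ≤-Reasoning
  ... | yes y≤a | no y≰b  = contradiction (≤-trans y≤a (<⇒≤ a<b)) y≰b
  ... | no y≰a  | yes y≤b rewrite sumUpTo-reject ys y≰a | sumUpTo-accept ys y≤b =
    m≤n⇒m≤o+n (g y) (sumUpTo-< a<b b∈ys)
  ... | no y≰a  | no y≰b  rewrite sumUpTo-reject ys y≰a | sumUpTo-reject ys y≰b =
    sumUpTo-< a<b b∈ys

open DecMembership _≟_ using () renaming (_∈?_ to _∈ℕ?_)

module AlgorithmBProperties {N : ℕ} (t : ℕ) (E : Execution N)
  (few-faulty : ∣ ∁ (Execution.correct E) ∣ ≤ t)
  (sender-injective : ∀ p → Injective _≡_ _≡_ (Execution.sender E p))
  (ident-injective : ∀ q q′ → q ∈ Execution.correct E → q′ ∈ Execution.correct E →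
    Execution.ident E q ≡ Execution.ident E q′ → q ≡ q′)
  where

  open Execution E
  open AlgorithmB t E

  correctProcesses : List (Fin N)
  correctProcesses = filter (_∈? correct) (allFin N)

  correctProcesses-unique : Unique correctProcesses
  correctProcesses-unique = filter⁺ (_∈? correct) (allFin⁺ N)

  correctProcesses⊆correct : ∀ {q} → q ∈ₗ correctProcesses → q ∈ correct
  correctProcesses⊆correct = proj₂ ∘ ∈-filter⁻ (_∈? correct) {xs = allFin N}

  length-correctProcesses : N ∸ t ≤ length correctProcesses
  length-correctProcesses = subst (N ∸ t ≤_)
    (sym (length-filter-tabulate (_∈? correct) correct id (λ _ → mk⇔ id id)))
    (∣∁p∣≤t⇒n∸t≤∣p∣ correct few-faulty)

  correctIds : List ℕ
  correctIds = map ident correctProcesses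

  correctIds-unique : Unique correctIds
  correctIds-unique = Unique-map⁺
    (λ q∈ q′∈ → ident-injective _ _ (correctProcesses⊆correct q∈) (correctProcesses⊆correct q′∈))
    correctProcesses-unique

  length-correctIds : N ∸ t ≤ length correctIds
  length-correctIds =
    subst (N ∸ t ≤_) (sym (length-map ident correctProcesses)) length-correctProcesses

  sender-surjective : ∀ p q → ∃ λ l → sender p l ≡ q
  sender-surjective p = injective⇒surjective (sender-injective p)

  isCorrect-true : ∀ {q} → q ∈ correct → isCorrect q ≡ true
  isCorrect-true {q} = dec-true (q ∈? correct)

  linkid-correct : ∀ {p l} → sender p l ∈ correct → linkid p l ≡ just (ident (sender p l))
  linkid-correct s∈ rewrite isCorrect-true s∈ = refl

  ident∈timely : ∀ p {q} → q ∈ correct → ident q ∈ₗ timely p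
  ident∈timely p {q} q∈ with l , refl ← sender-surjective p q =
    ∈-deduplicate⁺ _≟_ (∈-mapMaybe⁺ (linkid p) (∈-allFin l) (linkid-correct q∈))

  correctIds⊆timely : ∀ p → correctIds ⊆ timely p
  correctIds⊆timely p i∈ with q , q∈ , refl ← ∈-map⁻ ident i∈ =
    ident∈timely p (correctProcesses⊆correct q∈)

  length-timely : ∀ p → length (timely p) ≤ N
  length-timely p = begin
    length (timely p)                   ≤⟨ length-deduplicate _≟_ (mapMaybe (linkid p) links) ⟩
    length (mapMaybe (linkid p) links)  ≤⟨ length-catMaybes (map (linkid p) links) ⟩
    length (map (linkid p) links)       ≡⟨ length-map (linkid p) links ⟩
    length links                        ≡⟨ length-tabulate id ⟩
    N                                   ∎
    where open ≤-Reasoning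

  interSize-timely : ∀ p c → N ∸ t ≤ interSize p (timely c)
  interSize-timely p c = ≤-trans length-correctIds (Unique-⊆⇒length≤ correctIds-unique
    (λ i∈ → ∈-filter⁺ (_∈ℕ? timely p) (correctIds⊆timely c i∈) (correctIds⊆timely p i∈)))

  echo-correct : ∀ {p l} → sender p l ∈ correct → echo p l ≡ just (timely (sender p l))
  echo-correct s∈ rewrite isCorrect-true s∈ = refl

  acceptTest-correct : ∀ {p l} → sender p l ∈ correct → acceptTest p l (timely (sender p l)) ≡ true
  acceptTest-correct {p} {l} s∈
    rewrite linkid-correct s∈
          | dec-true (length (timely (sender p l)) ≤? N) (length-timely (sender p l))
          | dec-true (N ∸ t ≤? interSize p (timely (sender p l))) (interSize-timely p (sender p l))
    = refl

  acceptEcho-correct : ∀ {p l} → sender p l ∈ correct → acceptEcho p l ≡ just (timely (sender p l))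
  acceptEcho-correct {p} {l} s∈ with echo p l | echo-correct s∈
  ... | _ | refl rewrite acceptTest-correct s∈ = refl

  correctLinks : Fin N → List (Fin N)
  correctLinks p = filter (λ l → sender p l ∈? correct) links

  length-correctLinks : ∀ p → N ∸ t ≤ length (correctLinks p)
  length-correctLinks p = begin
    N ∸ t                                     ≤⟨ length-correctProcesses ⟩
    length correctProcesses                   ≤⟨ Unique-⊆⇒length≤ correctProcesses-unique reached ⟩
    length (map (sender p) (correctLinks p))  ≡⟨ length-map (sender p) (correctLinks p) ⟩
    length (correctLinks p)                   ∎
    where
    open ≤-Reasoning
    reached : correctProcesses ⊆ map (sender p) (correctLinks p)
    reached {q} q∈ with l , refl ← sender-surjective p q =
      ∈-map⁺ (sender p)
        (∈-filter⁺ (λ l → sender p l ∈? correct) (∈-allFin l) (correctProcesses⊆correct q∈))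

  counter-correct : ∀ p {q} → q ∈ correct → N ∸ t ≤ counter p (ident q)
  counter-correct p {q} q∈ = ≤-trans (length-correctLinks p)
    (length-filter≤length-filter-mapMaybe (acceptEcho p)
      (λ l → sender p l ∈? correct) (ident q ∈ℕ?_) echo∋ident links)
    where
    echo∋ident : ∀ {l} → sender p l ∈ correct → Maybe.Any (ident q ∈ₗ_) (acceptEcho p l)
    echo∋ident s∈ rewrite acceptEcho-correct s∈ = Maybe.just (ident∈timely _ q∈)

  ident∈accepted : ∀ p {q} → q ∈ correct → ident q ∈ₗ accepted p
  ident∈accepted p {q} q∈ with l , refl ← sender-surjective p q =
    ∈-deduplicate⁺ _≟_ (∈-concat⁺′ (ident∈timely _ q∈)
      (∈-mapMaybe⁺ (acceptEcho p) (∈-allFin l) (acceptEcho-correct q∈)))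

  newid-gap : ∀ p {q q′} → q ∈ correct → ident q′ < ident q →
    newid p (ident q′) + (N ∸ t) ≤ newid p (ident q)
  newid-gap p {q} {q′} q∈ id′<id = begin
    newid p (ident q′) + (N ∸ t)           ≡⟨ cong (newid p (ident q′) +_) (sym capped) ⟩
    newid p (ident q′) + weight (ident q)  ≤⟨ sumUpTo-< weight id′<id (ident∈accepted p q∈) ⟩
    newid p (ident q)                      ∎
    where
    open ≤-Reasoning
    weight : ℕ → ℕ
    weight y = counter p y ⊓ (N ∸ t)
    capped : weight (ident q) ≡ N ∸ t
    capped = m≥n⇒m⊓n≡n (counter-correct p q∈)

lemma11 : (N t : ℕ) → 2 * (t * t) + t < N → (E : Execution N) →
    ∣ ∁ (Execution.correct E) ∣ ≤ t →
    (∀ p → Injective _≡_ _≡_ (Execution.sender E p)) →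
    (∀ q q' → q ∈ Execution.correct E → q' ∈ Execution.correct E →
      Execution.ident E q ≡ Execution.ident E q' → q ≡ q') →
    ∀ p q q' → p ∈ Execution.correct E → q ∈ Execution.correct E → q' ∈ Execution.correct E →
    Execution.ident E q' < Execution.ident E q →
    (Execution.ident E q ∈ₗ AlgorithmB.accepted t E p) ×
    (Execution.ident E q' ∈ₗ AlgorithmB.accepted t E p) ×
    (AlgorithmB.newid t E p (Execution.ident E q') + (N ∸ t) ≤ AlgorithmB.newid t E p (Execution.ident E q))
lemma11 N t _ E few-faulty sender-injective ident-injective p q q′ _ q∈ q′∈ id′<id =
  ident∈accepted p q∈ , ident∈accepted p q′∈ , newid-gap p q∈ id′<id
  where open AlgorithmBProperties t E few-faulty sender-injective ident-injective
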